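{- Let $K=\mathbb{Q}(\sqrt{D})$ where $D\in\mathbb{Z}_{\ge2}$ is squarefree, and let $m\in\mathbb{Z}_{\ge1}$. Let $k_{\max}$ be a positive integer with $p_K(k_{\max})\ge m$, and let $y_{\max}\in\mathbb{Z}_{\ge0}$ satisfy $y_{\max}\ge\left\lfloor\frac{\varepsilon_+}{\xi_D+\omega_D}\right\rfloor$ and $p_K(\lceil y_{\max}\xi_D\rceil+y_{\max}\omega_D)\ge m$. Let $\alpha=(\lceil y\xi_D\rceil+k)+y\omega_D$ with $y,k\in\mathbb{Z}_{\ge0}$ and $\alpha\ne0$. If $\alpha/\alpha'\le\varepsilon_+$ and $p_K(\alpha)\le m$, then $k\le k_{\max}$ and $y\le y_{\max}$.
   Context: Let $\omega_D=\sqrt{D}$ and $\xi_D=\sqrt D$ if $D\equiv2,3\pmod4$, and $\omega_D=\frac{1+\sqrt D}{2}$, $\xi_D=\frac{\sqrt D-1}{2}$ if $D\equiv1\pmod4$; $'$ denotes Galois conjugation. $\mathcal{O}_K$ is the ring of integers of $K$, $\mathcal{O}_K^+$ the set of totally positive elements (those $\gamma$ with $\gamma>0$, $\gamma'>0$). $\varepsilon_+>1$ denotes the smallest totally positive unit of $\mathcal{O}_K$ greater than $1$. A partition of $\alpha\in\mathcal{O}_K^+$ is an expression $\alpha=\alpha_1+\dots+\alpha_n$ with $n\ge1$ and $\alpha_i\in\mathcal{O}_K^+$, order irrelevant; $p_K(\alpha)$ is the number of partitions of $\alpha$. -}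

module Defs where

open import Data.Nat as ℕ using (ℕ; _%_; _/_; _≡ᵇ_)
open import Data.Nat.Divisibility using (_∣_)
open import Data.Integer as ℤ using (ℤ; +_; _+_; _*_; -_; _-_; _≤_; _<_)
open import Data.Bool using (Bool; true; false; if_then_else_)
open import Data.Product using (_×_; _,_; Σ; ∃)
open import Data.Sum using (_⊎_)
open import Data.Fin using (Fin)
open import Data.List using (List; []; _∷_; foldr)
open import Data.List.Relation.Unary.All using (All)
open import Data.List.Relation.Binary.Permutation.Propositional using (_↭_)
open import Relation.Binary.PropositionalEquality using (_≡_)
open import Relation.Nullary using (¬_)

SquareFree : ℕ → Set
SquareFree D = ∀ p → p ℕ.* p ∣ D → p ≡ 1

one-mod4 : ℕ → Bool
one-mod4 D = (D % 4) ≡ᵇ 1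

-- element a + b·ω_D of O_K, stored as (a , b)
OK : Set
OK = ℤ × ℤ

ok : ℤ → OK
ok a = (a , + 0)

infixl 6 _⊕_
infixr 7 _·_

_⊕_ : OK → OK → OK
(a , b) ⊕ (c , d) = (a + c , b + d)

⊖_ : OK → OK
⊖ (a , b) = (- a , - b)

_·_ : ℤ → OK → OK
n · (a , b) = (n * a , n * b)

-- multiplication: ω² = D (D ≢ 1 mod 4), ω² = ω + (D-1)/4 (D ≡ 1 mod 4)
mul : ℕ → OK → OK → OK
mul D (a , b) (c , d) = if one-mod4 D
  then (a * c + b * d * + (D / 4) , a * d + b * c + b * d)
  else (a * c + b * d * + D , a * d + b * c)

-- Galois conjugation: ω' = -ω resp. ω' = 1 - ω
conj : ℕ → OK → OK
conj D (a , b) = if one-mod4 D then (a + b , - b) else (a , - b)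

ωD : ℕ → OK
ωD D = (+ 0 , + 1)

ξD : ℕ → OK
ξD D = if one-mod4 D then (- + 1 , + 1) else (+ 0 , + 1)

-- real embedding: a + bω = (A + B√D)/2
emb : ℕ → OK → ℤ × ℤ
emb D (a , b) = if one-mod4 D then (+ 2 * a + b , b) else (+ 2 * a , + 2 * b)

-- A + B√D > 0
PosR : ℕ → ℤ → ℤ → Set
PosR D A B =
  (+ 0 < A × + 0 ≤ B) ⊎ (+ 0 ≤ A × + 0 < B)
  ⊎ (+ 0 < A × B < + 0 × B * B * + D < A * A)
  ⊎ (A < + 0 × + 0 < B × A * A < B * B * + D)

-- A + B√D ≥ 0
NonNegR : ℕ → ℤ → ℤ → Set
NonNegR D A B =
  (+ 0 ≤ A × + 0 ≤ B)
  ⊎ (+ 0 ≤ A × B < + 0 × B * B * + D ≤ A * A)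
  ⊎ (A < + 0 × + 0 < B × A * A ≤ B * B * + D)

-- order on O_K ⊂ ℝ (via the embedding with √D > 0)
Pos : ℕ → OK → Set
Pos D x with emb D x
... | (A , B) = PosR D A B

Lt : ℕ → OK → OK → Set
Lt D x y with emb D (y ⊕ (⊖ x))
... | (A , B) = PosR D A B

Le : ℕ → OK → OK → Set
Le D x y with emb D (y ⊕ (⊖ x))
... | (A , B) = NonNegR D A B

TotPos : ℕ → OK → Set
TotPos D x = Pos D x × Pos D (conj D x)

Unit : ℕ → OK → Set
Unit D x = ∃ λ y → mul D x y ≡ ok (+ 1)

IsEpsPlus : ℕ → OK → Set
IsEpsPlus D ε =
  (TotPos D ε × Unit D ε × Lt D (ok (+ 1)) ε)
  × (∀ u → TotPos D u → Unit D u → Lt D (ok (+ 1)) u → Le D ε u)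

IsCeil : ℕ → OK → ℤ → Set
IsCeil D x c = Le D x (ok c) × Lt D (ok (c - + 1)) x

IsFloorDiv : ℕ → OK → OK → ℤ → Set
IsFloorDiv D x y f = Le D (f · y) x × Lt D x ((f + + 1) · y)

sumOK : List OK → OK
sumOK = foldr _⊕_ (ok (+ 0))

-- a partition of α (as a list; order is irrelevant, handled by ↭ below)
IsPartition : ℕ → OK → List OK → Set
IsPartition D α ps = ¬ (ps ≡ []) × All (TotPos D) ps × sumOK ps ≡ α

PK≡ : ℕ → OK → ℕ → Set
PK≡ D α n = Σ (Fin n → List OK) λ P →
  (∀ i → IsPartition D α (P i))
  × (∀ i j → P i ↭ P j → i ≡ j)
  × (∀ ps → IsPartition D α ps → ∃ λ i → ps ↭ P i)

PK≥ : ℕ → OK → ℕ → Set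
PK≥ D α m = ∃ λ n → PK≡ D α n × m ℕ.≤ n

PK≤ : ℕ → OK → ℕ → Set
PK≤ D α m = ∃ λ n → PK≡ D α n × n ℕ.≤ m

module Submission where

-- Write α′ for the conjugate of α = (⌈yξ⌉ + k) + yω. Since ξ = −ω′, α′ = (⌈yξ⌉ − yξ) + k ≥ k, and
-- α − α′ = y(ξ + ω) with ξ + ω > 0, so α is totally positive as soon as α′ > 0.
-- If k > k_max, then α − k_max is totally positive; prepending it to the partitions of k_max, together
-- with the one-part partition α, gives p_K(α) > p_K(k_max) ≥ m.
-- If y > y_max and α′ ≥ 1, the same argument works with β = ⌈y_max ξ⌉ + y_max ω, because β′ < 1.
-- If y > y_max and α′ < 1, then α ≤ εα′ ≤ ε < (⌊ε/(ξ+ω)⌋ + 1)(ξ + ω) ≤ y(ξ + ω) = α − α′ ≤ α.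

open import Defs
open import Data.Nat using (ℕ)
open import Data.Integer as ℤ using (ℤ; +_)

module IntegerInequalities where

  open import Data.Nat using (z≤n; s≤s)
  open import Data.Integer
  open import Data.Integer.Properties
  open import Data.Integer.Tactic.RingSolver using (solve-∀)
  open import Relation.Binary.PropositionalEquality
  open import Relation.Nullary using (yes; no)
  open import Data.Empty using (⊥-elim)

  nonNeg*nonNeg : ∀ {i j} → + 0 ≤ i → + 0 ≤ j → + 0 ≤ i * j
  nonNeg*nonNeg {j = j} 0≤i 0≤j = *-monoʳ-≤-nonNeg j {{nonNegative 0≤j}} 0≤i

  pos*pos : ∀ {i j} → + 0 < i → + 0 < j → + 0 < i * j
  pos*pos {j = j} 0<i 0<j = *-monoʳ-<-pos j {{positive 0<j}} 0<i

  neg-square : ∀ i → - i * - i ≡ i * i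
  neg-square = solve-∀

  neg*neg : ∀ {i j} → i < + 0 → j < + 0 → + 0 < i * j
  neg*neg {i} {j} i<0 j<0 = subst (+ 0 <_) (sym (neg*neg≡ i j)) (pos*pos (neg-mono-< i<0) (neg-mono-< j<0))
    where
    neg*neg≡ : ∀ i j → i * j ≡ - i * - j
    neg*neg≡ = solve-∀

  nonNeg*nonPos : ∀ {i j} → + 0 ≤ i → j ≤ + 0 → i * j ≤ + 0
  nonNeg*nonPos {i} 0≤i j≤0 = subst (i * _ ≤_) (*-zeroʳ i) (*-monoˡ-≤-nonNeg i {{nonNegative 0≤i}} j≤0)

  nonPos*nonPos : ∀ {i j} → i ≤ + 0 → j ≤ + 0 → + 0 ≤ i * j
  nonPos*nonPos {i} i≤0 j≤0 = subst (_≤ i * _) (*-zeroʳ i) (*-monoˡ-≤-nonPos i {{nonPositive i≤0}} j≤0)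

  0≤i*i : ∀ i → + 0 ≤ i * i
  0≤i*i +0 = +≤+ z≤n
  0≤i*i +[1+ n ] = +≤+ z≤n
  0≤i*i -[1+ n ] = +≤+ z≤n

  0<i*i : ∀ {i} → i ≢ + 0 → + 0 < i * i
  0<i*i {+0} i≢0 = ⊥-elim (i≢0 refl)
  0<i*i {+[1+ n ]} _ = +<+ (s≤s z≤n)
  0<i*i { -[1+ n ]} _ = +<+ (s≤s z≤n)

  0≤k*i⇒0≤i : ∀ {k i} → + 0 < k → + 0 ≤ k * i → + 0 ≤ i
  0≤k*i⇒0≤i {k} {i} 0<k 0≤ki =
    *-cancelˡ-≤-pos (+ 0) i k {{positive 0<k}} (subst (_≤ k * i) (sym (*-zeroʳ k)) 0≤ki)

  k*i≤0⇒i≤0 : ∀ {k i} → + 0 < k → k * i ≤ + 0 → i ≤ + 0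
  k*i≤0⇒i≤0 {k} {i} 0<k ki≤0 =
    *-cancelˡ-≤-pos i (+ 0) k {{positive 0<k}} (subst (k * i ≤_) (sym (*-zeroʳ k)) ki≤0)

  i<j⇒0<j-i : ∀ {i j} → i < j → + 0 < j - i
  i<j⇒0<j-i {i} {j} i<j = subst (_< j - i) (+-inverseʳ i) (+-monoˡ-< (- i) i<j)

  *-mono-≤-nonNeg : ∀ {p q r s} → + 0 ≤ p → p ≤ q → + 0 ≤ r → r ≤ s → p * r ≤ q * s
  *-mono-≤-nonNeg {p} {q} {r} 0≤p p≤q 0≤r r≤s = ≤-trans
    (*-monoʳ-≤-nonNeg r {{nonNegative 0≤r}} p≤q)
    (*-monoˡ-≤-nonNeg q {{nonNegative (≤-trans 0≤p p≤q)}} r≤s)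

  square-mono-≤ : ∀ {i j} → + 0 ≤ i → i ≤ j → i * i ≤ j * j
  square-mono-≤ 0≤i i≤j = *-mono-≤-nonNeg 0≤i i≤j 0≤i i≤j

  square-mono-< : ∀ {i j} → + 0 ≤ i → i < j → i * i < j * j
  square-mono-< {i} {j} 0≤i i<j = ≤-<-trans
    (*-monoˡ-≤-nonNeg i {{nonNegative 0≤i}} (<⇒≤ i<j))
    (*-monoʳ-<-pos j {{positive (≤-<-trans 0≤i i<j)}} i<j)

  square-antimono-≤ : ∀ {i j} → i ≤ j → j ≤ + 0 → j * j ≤ i * i
  square-antimono-≤ {i} {j} i≤j j≤0 =
    subst₂ _≤_ (neg-square j) (neg-square i) (square-mono-≤ (neg-mono-≤ j≤0) (neg-mono-≤ i≤j))

  square-cancel-≤ : ∀ {i j} → + 0 ≤ j → i * i ≤ j * j → i ≤ j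
  square-cancel-≤ {i} {j} 0≤j i²≤j² with i ≤? j
  ... | yes i≤j = i≤j
  ... | no i≰j = ⊥-elim (<⇒≱ (square-mono-< 0≤j (≰⇒> i≰j)) i²≤j²)

module Norm where

  open import Data.Integer using (_+_; _-_; _*_; -_)
  open import Data.Integer.Tactic.RingSolver using (solve-∀)
  open import Relation.Binary.PropositionalEquality using (_≡_)

  norm : ℤ → ℤ → ℤ → ℤ
  norm d a b = a * a - b * b * d

  norm-scale : ∀ d k a b → norm d (k * a) (k * b) ≡ k * k * norm d a b
  norm-scale d k a b = identity d k a b
    where
    identity : ∀ d k a b → k * a * (k * a) - k * b * (k * b) * d ≡ k * k * (a * a - b * b * d)
    identity = solve-∀

  norm-*√d : ∀ d a b → norm d (b * d) a ≡ - (d * norm d a b)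
  norm-*√d d a b = identity d a b
    where
    identity : ∀ d a b → b * d * (b * d) - a * a * d ≡ - (d * (a * a - b * b * d))
    identity = solve-∀

  norm-neg : ∀ d a b → norm d (- a) (- b) ≡ norm d a b
  norm-neg d a b = identity d a b
    where
    identity : ∀ d a b → - a * - a - - b * - b * d ≡ a * a - b * b * d
    identity = solve-∀

  norm-* : ∀ d a b c e → norm d (a * c + b * e * d) (a * e + b * c) ≡ norm d a b * norm d c e
  norm-* d a b c e = identity d a b c e
    where
    identity : ∀ d a b c e → (a * c + b * e * d) * (a * c + b * e * d) - (a * e + b * c) * (a * e + b * c) * d
                           ≡ (a * a - b * b * d) * (c * c - e * e * d)
    identity = solve-∀

module OKGroup where

  open import Data.Integer using (_+_; -_; _-_; _*_)
  open import Data.Integer.Properties using (+-comm; +-identityʳ; +-inverseʳ)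
  open import Data.Integer.Tactic.RingSolver using (solve-∀)
  open import Data.Product using (_,_)
  open import Relation.Binary.PropositionalEquality

  ⊕-comm : ∀ x y → x ⊕ y ≡ y ⊕ x
  ⊕-comm (a , b) (c , e) = cong₂ _,_ (+-comm a c) (+-comm b e)

  ⊕-identityʳ : ∀ x → x ⊕ ok (+ 0) ≡ x
  ⊕-identityʳ (a , b) = cong₂ _,_ (+-identityʳ a) (+-identityʳ b)

  ⊖-self : ∀ x → x ⊕ ⊖ x ≡ ok (+ 0)
  ⊖-self (a , b) = cong₂ _,_ (+-inverseʳ a) (+-inverseʳ b)

  ⊖-telescope : ∀ x y z → (z ⊕ ⊖ y) ⊕ (y ⊕ ⊖ x) ≡ z ⊕ ⊖ x
  ⊖-telescope (a , b) (c , e) (f , g) = cong₂ _,_ (telescope a c f) (telescope b e g)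
    where
    telescope : ∀ a c f → f + - c + (c + - a) ≡ f + - a
    telescope = solve-∀

  ⊖-flip : ∀ x y → ⊖ (y ⊕ ⊖ x) ≡ x ⊕ ⊖ y
  ⊖-flip (a , b) (c , e) = cong₂ _,_ (flip a c) (flip b e)
    where
    flip : ∀ a c → - (c + - a) ≡ a + - c
    flip = solve-∀

  ⊕-⊖-cancel : ∀ x y → y ⊕ (x ⊕ ⊖ y) ≡ x
  ⊕-⊖-cancel (a , b) (c , e) = cong₂ _,_ (cancel a c) (cancel b e)
    where
    cancel : ∀ a c → c + (a + - c) ≡ a
    cancel = solve-∀

  ⊖-⊖-cancel : ∀ x y → x ⊕ ⊖ (x ⊕ ⊖ y) ≡ y
  ⊖-⊖-cancel (a , b) (c , e) = cong₂ _,_ (cancel a c) (cancel b e)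
    where
    cancel : ∀ a c → a + - (a + - c) ≡ c
    cancel = solve-∀

  ·-distribʳ-⊖ : ∀ m n x → (n - m) · x ≡ n · x ⊕ ⊖ (m · x)
  ·-distribʳ-⊖ m n (a , b) = cong₂ _,_ (distrib m n a) (distrib m n b)
    where
    distrib : ∀ m n a → (n - m) * a ≡ n * a + - (m * a)
    distrib = solve-∀

module RealQuadraticSigns (D : ℕ) (0<D : + 0 ℤ.< + D) where

  open import Data.Integer
  open import Data.Integer.Properties
  open import Data.Integer.Tactic.RingSolver using (solve; solve-∀)
  open import Data.List using (_∷_; [])
  open import Data.Product using (_,_)
  open import Data.Sum using (inj₁; inj₂)
  open import Relation.Binary.PropositionalEquality
  open import Relation.Nullary using (¬_; yes; no; Dec)
  open import Relation.Nullary.Decidable using (_×-dec_; _⊎-dec_)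
  open import Data.Empty using (⊥-elim)
  open IntegerInequalities
  open Norm

  pattern signs≥0 a b = inj₁ (a , b)
  pattern rational-dominant a b n = inj₂ (inj₁ (a , b , n))
  pattern surd-dominant a b n = inj₂ (inj₂ (a , b , n))

  pattern pos-rational a b = inj₁ (a , b)
  pattern pos-surd a b = inj₂ (inj₁ (a , b))
  pattern pos-rational-dominant a b n = inj₂ (inj₂ (inj₁ (a , b , n)))
  pattern pos-surd-dominant a b n = inj₂ (inj₂ (inj₂ (a , b , n)))

  N : ℤ → ℤ → ℤ
  N = norm (+ D)

  0≤D : + 0 ≤ + D
  0≤D = <⇒≤ 0<D

  0≤N : ∀ A B → B * B * + D ≤ A * A → + 0 ≤ N A B
  0≤N _ _ = i≤j⇒0≤j-i

  N≤0 : ∀ A B → A * A ≤ B * B * + D → N A B ≤ + 0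
  N≤0 _ _ = i≤j⇒i-j≤0

  norm≥0⇒nonneg : ∀ {A B} → + 0 ≤ A → + 0 ≤ N A B → NonNegR D A B
  norm≥0⇒nonneg {A} {B} 0≤A 0≤N with + 0 ≤? B
  ... | yes 0≤B = signs≥0 0≤A 0≤B
  ... | no B≱0 = rational-dominant 0≤A (≰⇒> B≱0) (0≤i-j⇒j≤i 0≤N)

  norm≤0⇒nonneg : ∀ {A B} → + 0 ≤ B → N A B ≤ + 0 → NonNegR D A B
  norm≤0⇒nonneg {A} {B} 0≤B N≤0 with + 0 ≤? A
  ... | yes 0≤A = signs≥0 0≤A 0≤B
  ... | no A≱0 = surd-dominant A<0 (≤∧≢⇒< 0≤B B≢0) (i-j≤0⇒i≤j N≤0)
    where
    A<0 = ≰⇒> A≱0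
    B≢0 : + 0 ≢ B
    B≢0 refl = <⇒≱ (0<i*i (<⇒≢ A<0)) (i-j≤0⇒i≤j N≤0)

  nonneg-mono : ∀ {A B A′ B′} → NonNegR D A B → A ≤ A′ → B ≤ B′ → NonNegR D A′ B′
  nonneg-mono (signs≥0 0≤A 0≤B) A≤A′ B≤B′ = signs≥0 (≤-trans 0≤A A≤A′) (≤-trans 0≤B B≤B′)
  nonneg-mono {A} {B} {A′} {B′} (rational-dominant 0≤A B<0 BBD≤AA) A≤A′ B≤B′ with + 0 ≤? B′
  ... | yes 0≤B′ = signs≥0 (≤-trans 0≤A A≤A′) 0≤B′
  ... | no B′≱0 = rational-dominant (≤-trans 0≤A A≤A′) B′<0 (begin
    B′ * B′ * + D ≤⟨ *-monoʳ-≤-nonNeg (+ D) (square-antimono-≤ B≤B′ (<⇒≤ B′<0)) ⟩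
    B * B * + D   ≤⟨ BBD≤AA ⟩
    A * A         ≤⟨ square-mono-≤ 0≤A A≤A′ ⟩
    A′ * A′       ∎)
    where
    open ≤-Reasoning
    B′<0 = ≰⇒> B′≱0
  nonneg-mono {A} {B} {A′} {B′} (surd-dominant A<0 0<B AA≤BBD) A≤A′ B≤B′ with + 0 ≤? A′
  ... | yes 0≤A′ = signs≥0 0≤A′ (≤-trans (<⇒≤ 0<B) B≤B′)
  ... | no A′≱0 = surd-dominant A′<0 (<-≤-trans 0<B B≤B′) (begin
    A′ * A′       ≤⟨ square-antimono-≤ A≤A′ (<⇒≤ A′<0) ⟩
    A * A         ≤⟨ AA≤BBD ⟩
    B * B * + D   ≤⟨ *-monoʳ-≤-nonNeg (+ D) (square-mono-≤ (<⇒≤ 0<B) B≤B′) ⟩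
    B′ * B′ * + D ∎)
    where
    open ≤-Reasoning
    A′<0 = ≰⇒> A′≱0

  nonneg-+-rational : ∀ {r A B} → + 0 ≤ r → NonNegR D A B → NonNegR D (r + A) B
  nonneg-+-rational {r} {A} 0≤r x≥0 = nonneg-mono x≥0 (i≤j+i A r {{nonNegative 0≤r}}) ≤-refl

  nonneg-scale : ∀ {k A B} → + 0 ≤ k → NonNegR D A B → NonNegR D (k * A) (k * B)
  nonneg-scale 0≤k (signs≥0 0≤A 0≤B) = signs≥0 (nonNeg*nonNeg 0≤k 0≤A) (nonNeg*nonNeg 0≤k 0≤B)
  nonneg-scale {k} {A} {B} 0≤k (rational-dominant 0≤A _ BBD≤AA) =
    norm≥0⇒nonneg (nonNeg*nonNeg 0≤k 0≤A)
      (subst (+ 0 ≤_) (sym (norm-scale (+ D) k A B)) (nonNeg*nonNeg (0≤i*i k) (0≤N A B BBD≤AA)))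
  nonneg-scale {k} {A} {B} 0≤k (surd-dominant _ 0<B AA≤BBD) =
    norm≤0⇒nonneg (nonNeg*nonNeg 0≤k (<⇒≤ 0<B))
      (subst (_≤ + 0) (sym (norm-scale (+ D) k A B)) (nonNeg*nonPos (0≤i*i k) (N≤0 A B AA≤BBD)))

  nonneg-cancel : ∀ {k A B} → + 0 < k → NonNegR D (k * A) (k * B) → NonNegR D A B
  nonneg-cancel 0<k (signs≥0 0≤kA 0≤kB) = signs≥0 (0≤k*i⇒0≤i 0<k 0≤kA) (0≤k*i⇒0≤i 0<k 0≤kB)
  nonneg-cancel {k} {A} {B} 0<k (rational-dominant 0≤kA _ n) =
    norm≥0⇒nonneg (0≤k*i⇒0≤i 0<k 0≤kA)
      (0≤k*i⇒0≤i (pos*pos 0<k 0<k) (subst (+ 0 ≤_) (norm-scale (+ D) k A B) (0≤N (k * A) (k * B) n)))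
  nonneg-cancel {k} {A} {B} 0<k (surd-dominant _ 0<kB n) =
    norm≤0⇒nonneg (0≤k*i⇒0≤i 0<k (<⇒≤ 0<kB))
      (k*i≤0⇒i≤0 (pos*pos 0<k 0<k) (subst (_≤ + 0) (norm-scale (+ D) k A B) (N≤0 (k * A) (k * B) n)))

  nonneg-*√D : ∀ {A B} → NonNegR D A B → NonNegR D (B * + D) A
  nonneg-*√D (signs≥0 0≤A 0≤B) = signs≥0 (nonNeg*nonNeg 0≤B 0≤D) 0≤A
  nonneg-*√D {A} {B} (rational-dominant 0≤A _ n) =
    norm≤0⇒nonneg 0≤A (subst (_≤ + 0) (sym (norm-*√d (+ D) A B)) (neg-mono-≤ (nonNeg*nonNeg 0≤D (0≤N A B n))))
  nonneg-*√D {A} {B} (surd-dominant _ 0<B n) =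
    norm≥0⇒nonneg (nonNeg*nonNeg (<⇒≤ 0<B) 0≤D)
      (subst (+ 0 ≤_) (sym (norm-*√d (+ D) A B)) (neg-mono-≤ (nonNeg*nonPos 0≤D (N≤0 A B n))))

  -- For x = A + B√D and y = C + E√D, E·x − B·y is rational; this lets nonneg-+ write a positive
  -- multiple of x + y as a nonnegative rational plus a nonnegative multiple of x or of y.
  nonneg-combination : ∀ {k l r P Q S T} → + 0 < k → + 0 ≤ l → + 0 ≤ r → NonNegR D P Q
    → k * S ≡ r + l * P → k * T ≡ l * Q → NonNegR D S T
  nonneg-combination 0<k 0≤l 0≤r x kS≡ kT≡ = nonneg-cancel 0<k
    (subst₂ (NonNegR D) (sym kS≡) (sym kT≡) (nonneg-+-rational 0≤r (nonneg-scale 0≤l x)))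

  -- |B|·√D ≤ A and |C| ≤ E·√D, multiplied.
  cross-bound : ∀ {A B C E} → + 0 ≤ A → + 0 ≤ E → B * B * + D ≤ A * A → C * C ≤ E * E * + D
    → B * C ≤ A * E
  cross-bound {A} {B} {C} {E} 0≤A 0≤E BBD≤AA CC≤EED = square-cancel-≤ (nonNeg*nonNeg 0≤A 0≤E)
    (*-cancelʳ-≤-pos _ _ (+ D) {{positive 0<D}}
      (subst₂ _≤_ (interchangeˡ B C (+ D)) (interchangeʳ A E (+ D))
        (*-mono-≤-nonNeg (nonNeg*nonNeg (0≤i*i B) 0≤D) BBD≤AA (0≤i*i C) CC≤EED)))
    where
    interchangeˡ : ∀ x y d → x * x * d * (y * y) ≡ x * y * (x * y) * d
    interchangeˡ = solve-∀
    interchangeʳ : ∀ x y d → x * x * (y * y * d) ≡ x * y * (x * y) * d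
    interchangeʳ = solve-∀

  nonneg-+-mixed : ∀ {A B C E} → + 0 ≤ A → B < + 0 → B * B * + D ≤ A * A
    → C < + 0 → + 0 < E → C * C ≤ E * E * + D → NonNegR D (A + C) (B + E)
  nonneg-+-mixed {A} {B} {C} {E} 0≤A B<0 BBD≤AA C<0 0<E CC≤EED
    with + 0 ≤? B + E | i≤j⇒0≤j-i (cross-bound {A} {B} {C} {E} 0≤A (<⇒≤ 0<E) BBD≤AA CC≤EED)
  ... | yes 0≤B+E | 0≤AE-BC =
    nonneg-combination 0<E 0≤B+E 0≤AE-BC (surd-dominant C<0 0<E CC≤EED) eqS eqT
    where
    eqS : E * (A + C) ≡ A * E - B * C + (B + E) * C
    eqS = solve (A ∷ B ∷ C ∷ E ∷ [])
    eqT : E * (B + E) ≡ (B + E) * E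
    eqT = solve (B ∷ E ∷ [])
  ... | no B+E≱0 | 0≤AE-BC =
    nonneg-combination (neg-mono-< B<0) (neg-mono-≤ (<⇒≤ (≰⇒> B+E≱0))) 0≤AE-BC
      (rational-dominant 0≤A B<0 BBD≤AA) eqS eqT
    where
    eqS : - B * (A + C) ≡ A * E - B * C + - (B + E) * A
    eqS = solve (A ∷ B ∷ C ∷ E ∷ [])
    eqT : - B * (B + E) ≡ - (B + E) * B
    eqT = solve (B ∷ E ∷ [])

  nonneg-+ : ∀ {A B C E} → NonNegR D A B → NonNegR D C E → NonNegR D (A + C) (B + E)
  nonneg-+ {A} {B} {C} {E} (signs≥0 0≤A 0≤B) y≥0 =
    nonneg-mono y≥0 (i≤j+i C A {{nonNegative 0≤A}}) (i≤j+i E B {{nonNegative 0≤B}})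
  nonneg-+ {A} {B} {C} {E} x≥0 (signs≥0 0≤C 0≤E) =
    nonneg-mono x≥0 (i≤i+j A C {{nonNegative 0≤C}}) (i≤i+j B E {{nonNegative 0≤E}})
  nonneg-+ {A} {B} {C} {E} x≥0@(rational-dominant _ B<0 _) y≥0@(rational-dominant _ E<0 _)
    with ≤-total (E * A) (B * C) | neg-mono-≤ (<⇒≤ (+-mono-< B<0 E<0))
  ... | inj₁ EA≤BC | 0≤-[B+E] = nonneg-combination (neg-mono-< E<0) 0≤-[B+E] (i≤j⇒0≤j-i EA≤BC) y≥0 eqS eqT
    where
    eqS : - E * (A + C) ≡ B * C - E * A + - (B + E) * C
    eqS = solve (A ∷ B ∷ C ∷ E ∷ [])
    eqT : - E * (B + E) ≡ - (B + E) * E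
    eqT = solve (B ∷ E ∷ [])
  ... | inj₂ BC≤EA | 0≤-[B+E] = nonneg-combination (neg-mono-< B<0) 0≤-[B+E] (i≤j⇒0≤j-i BC≤EA) x≥0 eqS eqT
    where
    eqS : - B * (A + C) ≡ E * A - B * C + - (B + E) * A
    eqS = solve (A ∷ B ∷ C ∷ E ∷ [])
    eqT : - B * (B + E) ≡ - (B + E) * B
    eqT = solve (B ∷ E ∷ [])
  nonneg-+ {A} {B} {C} {E} x≥0@(surd-dominant _ 0<B _) y≥0@(surd-dominant _ 0<E _)
    with ≤-total (B * C) (E * A) | <⇒≤ (+-mono-< 0<B 0<E)
  ... | inj₁ BC≤EA | 0≤B+E = nonneg-combination 0<E 0≤B+E (i≤j⇒0≤j-i BC≤EA) y≥0 eqS eqT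
    where
    eqS : E * (A + C) ≡ E * A - B * C + (B + E) * C
    eqS = solve (A ∷ B ∷ C ∷ E ∷ [])
    eqT : E * (B + E) ≡ (B + E) * E
    eqT = solve (B ∷ E ∷ [])
  ... | inj₂ EA≤BC | 0≤B+E = nonneg-combination 0<B 0≤B+E (i≤j⇒0≤j-i EA≤BC) x≥0 eqS eqT
    where
    eqS : B * (A + C) ≡ B * C - E * A + (B + E) * A
    eqS = solve (A ∷ B ∷ C ∷ E ∷ [])
    eqT : B * (B + E) ≡ (B + E) * B
    eqT = solve (B ∷ E ∷ [])
  nonneg-+ (rational-dominant 0≤A B<0 x) (surd-dominant C<0 0<E y) = nonneg-+-mixed 0≤A B<0 x C<0 0<E y
  nonneg-+ {A} {B} {C} {E} (surd-dominant A<0 0<B x) (rational-dominant 0≤C E<0 y) =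
    subst₂ (NonNegR D) (+-comm C A) (+-comm E B) (nonneg-+-mixed 0≤C E<0 y A<0 0<B x)

  nonneg-*-signs≥0 : ∀ {A B C E} → + 0 ≤ A → + 0 ≤ B → NonNegR D C E
    → NonNegR D (A * C + B * E * + D) (A * E + B * C)
  nonneg-*-signs≥0 {A} {B} {C} {E} 0≤A 0≤B y≥0 =
    subst (λ t → NonNegR D (A * C + t) (A * E + B * C)) (sym (*-assoc B E (+ D)))
      (nonneg-+ (nonneg-scale 0≤A y≥0) (nonneg-scale 0≤B (nonneg-*√D y≥0)))

  nonneg-* : ∀ {A B C E} → NonNegR D A B → NonNegR D C E → NonNegR D (A * C + B * E * + D) (A * E + B * C)
  nonneg-* (signs≥0 0≤A 0≤B) y≥0 = nonneg-*-signs≥0 0≤A 0≤B y≥0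
  nonneg-* {A} {B} {C} {E} x≥0 (signs≥0 0≤C 0≤E) = subst₂ (NonNegR D)
    (cong₂ _+_ (*-comm C A) (cong (_* + D) (*-comm E B)))
    (trans (+-comm (C * B) (E * A)) (cong₂ _+_ (*-comm E A) (*-comm C B)))
    (nonneg-*-signs≥0 0≤C 0≤E x≥0)
  nonneg-* {A} {B} {C} {E} (rational-dominant 0≤A B<0 n) (rational-dominant 0≤C E<0 m) = norm≥0⇒nonneg
    (+-mono-≤ (nonNeg*nonNeg 0≤A 0≤C) (nonNeg*nonNeg (<⇒≤ (neg*neg B<0 E<0)) 0≤D))
    (subst (+ 0 ≤_) (sym (norm-* (+ D) A B C E)) (nonNeg*nonNeg (0≤N A B n) (0≤N C E m)))
  nonneg-* {A} {B} {C} {E} (surd-dominant A<0 0<B n) (surd-dominant C<0 0<E m) = norm≥0⇒nonneg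
    (+-mono-≤ (<⇒≤ (neg*neg A<0 C<0)) (nonNeg*nonNeg (<⇒≤ (pos*pos 0<B 0<E)) 0≤D))
    (subst (+ 0 ≤_) (sym (norm-* (+ D) A B C E)) (nonPos*nonPos (N≤0 A B n) (N≤0 C E m)))
  nonneg-* {A} {B} {C} {E} (rational-dominant 0≤A B<0 n) (surd-dominant C<0 0<E m) = norm≤0⇒nonneg
    (+-mono-≤ (nonNeg*nonNeg 0≤A (<⇒≤ 0<E)) (<⇒≤ (neg*neg B<0 C<0)))
    (subst (_≤ + 0) (sym (norm-* (+ D) A B C E)) (nonNeg*nonPos (0≤N A B n) (N≤0 C E m)))
  nonneg-* {A} {B} {C} {E} (surd-dominant A<0 0<B n) (rational-dominant 0≤C E<0 m) = norm≤0⇒nonneg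
    (+-mono-≤ (<⇒≤ (neg*neg A<0 E<0)) (nonNeg*nonNeg (<⇒≤ 0<B) 0≤C))
    (subst (_≤ + 0) (trans (*-comm (N C E) (N A B)) (sym (norm-* (+ D) A B C E)))
      (nonNeg*nonPos (0≤N C E m) (N≤0 A B n)))

  ¬nonneg⇒nonneg-neg : ∀ {A B} → ¬ NonNegR D A B → NonNegR D (- A) (- B)
  ¬nonneg⇒nonneg-neg {A} {B} ¬x≥0 with + 0 ≤? A | + 0 ≤? B | + 0 ≤? N A B
  ... | yes 0≤A | yes 0≤B | _ = ⊥-elim (¬x≥0 (signs≥0 0≤A 0≤B))
  ... | yes 0≤A | no _ | yes 0≤N = ⊥-elim (¬x≥0 (norm≥0⇒nonneg 0≤A 0≤N))
  ... | yes _ | no B≱0 | no N≱0 = norm≤0⇒nonneg (neg-mono-≤ (<⇒≤ (≰⇒> B≱0)))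
    (subst (_≤ + 0) (sym (norm-neg (+ D) A B)) (<⇒≤ (≰⇒> N≱0)))
  ... | no A≱0 | no B≱0 | _ = signs≥0 (neg-mono-≤ (<⇒≤ (≰⇒> A≱0))) (neg-mono-≤ (<⇒≤ (≰⇒> B≱0)))
  ... | no A≱0 | yes _ | yes 0≤N = norm≥0⇒nonneg (neg-mono-≤ (<⇒≤ (≰⇒> A≱0)))
    (subst (+ 0 ≤_) (sym (norm-neg (+ D) A B)) 0≤N)
  ... | no _ | yes 0≤B | no N≱0 = ⊥-elim (¬x≥0 (norm≤0⇒nonneg 0≤B (<⇒≤ (≰⇒> N≱0))))

  nonneg? : ∀ A B → Dec (NonNegR D A B)
  nonneg? A B = (+ 0 ≤? A ×-dec + 0 ≤? B)
    ⊎-dec (+ 0 ≤? A ×-dec B <? + 0 ×-dec B * B * + D ≤? A * A)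
    ⊎-dec (A <? + 0 ×-dec + 0 <? B ×-dec A * A ≤? B * B * + D)

  pos⇒nonneg : ∀ {A B} → PosR D A B → NonNegR D A B
  pos⇒nonneg (pos-rational 0<A 0≤B) = signs≥0 (<⇒≤ 0<A) 0≤B
  pos⇒nonneg (pos-surd 0≤A 0<B) = signs≥0 0≤A (<⇒≤ 0<B)
  pos⇒nonneg (pos-rational-dominant 0<A B<0 n) = rational-dominant (<⇒≤ 0<A) B<0 (<⇒≤ n)
  pos⇒nonneg (pos-surd-dominant A<0 0<B n) = surd-dominant A<0 0<B (<⇒≤ n)

  private
    0≤-i⇒i≤0 : ∀ {i} → + 0 ≤ - i → i ≤ + 0
    0≤-i⇒i≤0 {i} = neg-cancel-≤ {+ 0} {i}

    0<-i⇒i<0 : ∀ {i} → + 0 < - i → i < + 0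
    0<-i⇒i<0 {i} = neg-cancel-< {+ 0} {i}

    -i<0⇒0<i : ∀ {i} → - i < + 0 → + 0 < i
    -i<0⇒0<i {i} = neg-cancel-< {i} {+ 0}

    neg-square-D : ∀ i → - i * - i * + D ≡ i * i * + D
    neg-square-D i = cong (_* + D) (neg-square i)

  pos⇒¬nonneg-neg : ∀ {A B} → PosR D A B → ¬ NonNegR D (- A) (- B)
  pos⇒¬nonneg-neg (pos-rational 0<A _) (signs≥0 0≤-A _) = <⇒≱ 0<A (0≤-i⇒i≤0 0≤-A)
  pos⇒¬nonneg-neg (pos-rational 0<A _) (rational-dominant 0≤-A _ _) = <⇒≱ 0<A (0≤-i⇒i≤0 0≤-A)
  pos⇒¬nonneg-neg (pos-rational _ 0≤B) (surd-dominant _ 0<-B _) = <⇒≱ (0<-i⇒i<0 0<-B) 0≤B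
  pos⇒¬nonneg-neg (pos-surd _ 0<B) (signs≥0 _ 0≤-B) = <⇒≱ 0<B (0≤-i⇒i≤0 0≤-B)
  pos⇒¬nonneg-neg {A} {B} (pos-surd 0≤A 0<B) (rational-dominant 0≤-A _ n)
    with ≤-antisym (0≤-i⇒i≤0 0≤-A) 0≤A
  ... | refl = <⇒≱ (pos*pos (0<i*i (≢-sym (<⇒≢ 0<B))) 0<D) (subst (_≤ + 0) (neg-square-D B) n)
  pos⇒¬nonneg-neg (pos-surd _ 0<B) (surd-dominant _ 0<-B _) = <⇒≱ 0<B (<⇒≤ (0<-i⇒i<0 0<-B))
  pos⇒¬nonneg-neg (pos-rational-dominant 0<A _ _) (signs≥0 0≤-A _) = <⇒≱ 0<A (0≤-i⇒i≤0 0≤-A)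
  pos⇒¬nonneg-neg (pos-rational-dominant 0<A _ _) (rational-dominant 0≤-A _ _) = <⇒≱ 0<A (0≤-i⇒i≤0 0≤-A)
  pos⇒¬nonneg-neg {A} {B} (pos-rational-dominant _ _ n) (surd-dominant _ _ m) =
    <⇒≱ n (subst₂ _≤_ (neg-square A) (neg-square-D B) m)
  pos⇒¬nonneg-neg (pos-surd-dominant _ 0<B _) (signs≥0 _ 0≤-B) = <⇒≱ 0<B (0≤-i⇒i≤0 0≤-B)
  pos⇒¬nonneg-neg {A} {B} (pos-surd-dominant _ _ n) (rational-dominant _ _ m) =
    <⇒≱ n (subst₂ _≤_ (neg-square-D B) (neg-square A) m)
  pos⇒¬nonneg-neg (pos-surd-dominant A<0 _ _) (surd-dominant -A<0 _ _) = <-asym A<0 (-i<0⇒0<i -A<0)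

  nonneg∧¬nonneg-neg⇒pos : ∀ {A B} → NonNegR D A B → ¬ NonNegR D (- A) (- B) → PosR D A B
  nonneg∧¬nonneg-neg⇒pos {A} {B} (signs≥0 0≤A 0≤B) ¬-x≥0 with + 0 <? A | + 0 <? B
  ... | yes 0<A | _ = pos-rational 0<A 0≤B
  ... | no _ | yes 0<B = pos-surd 0≤A 0<B
  ... | no A≯0 | no B≯0 = ⊥-elim (¬-x≥0 (signs≥0 (neg-mono-≤ (≮⇒≥ A≯0)) (neg-mono-≤ (≮⇒≥ B≯0))))
  nonneg∧¬nonneg-neg⇒pos {A} {B} (rational-dominant 0≤A B<0 _) ¬-x≥0 with B * B * + D <? A * A
  ... | yes BBD<AA = pos-rational-dominant (≤∧≢⇒< 0≤A A≢0) B<0 BBD<AA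
    where
    A≢0 : + 0 ≢ A
    A≢0 refl = <⇒≱ BBD<AA (nonNeg*nonNeg (0≤i*i B) 0≤D)
  ... | no BBD≮AA = ⊥-elim (¬-x≥0 (norm≤0⇒nonneg (neg-mono-≤ (<⇒≤ B<0))
    (subst (_≤ + 0) (sym (norm-neg (+ D) A B)) (N≤0 A B (≮⇒≥ BBD≮AA)))))
  nonneg∧¬nonneg-neg⇒pos {A} {B} (surd-dominant A<0 0<B _) ¬-x≥0 with A * A <? B * B * + D
  ... | yes AA<BBD = pos-surd-dominant A<0 0<B AA<BBD
  ... | no AA≮BBD = ⊥-elim (¬-x≥0 (norm≥0⇒nonneg (neg-mono-≤ (<⇒≤ A<0))
    (subst (+ 0 ≤_) (sym (norm-neg (+ D) A B)) (0≤N A B (≮⇒≥ AA≮BBD)))))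

  pos-+-nonneg : ∀ {A B C E} → PosR D A B → NonNegR D C E → PosR D (A + C) (B + E)
  pos-+-nonneg {A} {B} {C} {E} x>0 y≥0 = nonneg∧¬nonneg-neg⇒pos (nonneg-+ (pos⇒nonneg x>0) y≥0)
    λ -[x+y]≥0 → pos⇒¬nonneg-neg x>0 (subst₂ (NonNegR D) (cancel A C) (cancel B E) (nonneg-+ -[x+y]≥0 y≥0))
    where
    cancel : ∀ a c → - (a + c) + c ≡ - a
    cancel a c = solve (a ∷ c ∷ [])

  ¬pos-0 : ¬ PosR D (+ 0) (+ 0)
  ¬pos-0 0>0 = pos⇒¬nonneg-neg 0>0 (signs≥0 ≤-refl ≤-refl)

module Embedding (D : ℕ) where

  open import Data.Nat as ℕ using (_%_; _/_)
  open import Data.Nat.Properties using (≡ᵇ⇒≡)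
  open import Data.Nat.DivMod using (m≡m%n+[m/n]*n)
  open import Data.Integer using (_+_; _*_; -_)
  open import Data.Integer.Properties using (pos-+; pos-*; *-comm; *-distribˡ-+; neg-distribʳ-*; +-identityʳ)
  open import Data.Integer.Tactic.RingSolver using (solve-∀)
  open import Data.Bool using (true; false; T)
  open import Data.Product using (_,_)
  open import Relation.Binary.PropositionalEquality

  _⊗_ : OK → OK → OK
  (A , B) ⊗ (C , E) = (A * C + B * E * + D , A * E + B * C)

  D≡1+4[D/4] : one-mod4 D ≡ true → + D ≡ + 1 + + 4 * + (D / 4)
  D≡1+4[D/4] eq = begin
    + D                       ≡⟨ cong +_ (m≡m%n+[m/n]*n D 4) ⟩
    + (D % 4 ℕ.+ D / 4 ℕ.* 4) ≡⟨ cong (λ r → + (r ℕ.+ D / 4 ℕ.* 4)) D%4≡1 ⟩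
    + (1 ℕ.+ D / 4 ℕ.* 4)     ≡⟨ pos-+ 1 (D / 4 ℕ.* 4) ⟩
    + 1 + + (D / 4 ℕ.* 4)     ≡⟨ cong (λ t → + 1 + t) (trans (pos-* (D / 4) 4) (*-comm (+ (D / 4)) (+ 4))) ⟩
    + 1 + + 4 * + (D / 4)     ∎
    where
    open ≡-Reasoning
    D%4≡1 : D % 4 ≡ 1
    D%4≡1 = ≡ᵇ⇒≡ (D % 4) 1 (subst T (sym eq) _)

  emb-⊕ : ∀ x y → emb D (x ⊕ y) ≡ emb D x ⊕ emb D y
  emb-⊕ (a , b) (c , e) with one-mod4 D
  ... | true = cong₂ _,_ (identity a b c e) refl
    where
    identity : ∀ a b c e → + 2 * (a + c) + (b + e) ≡ + 2 * a + b + (+ 2 * c + e)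
    identity = solve-∀
  ... | false = cong₂ _,_ (*-distribˡ-+ (+ 2) a c) (*-distribˡ-+ (+ 2) b e)

  emb-⊖ : ∀ x → emb D (⊖ x) ≡ ⊖ emb D x
  emb-⊖ (a , b) with one-mod4 D
  ... | true = cong₂ _,_ (identity a b) refl
    where
    identity : ∀ a b → + 2 * - a + - b ≡ - (+ 2 * a + b)
    identity = solve-∀
  ... | false = cong₂ _,_ (sym (neg-distribʳ-* (+ 2) a)) (sym (neg-distribʳ-* (+ 2) b))

  emb-· : ∀ n x → emb D (n · x) ≡ n · emb D x
  emb-· n (a , b) with one-mod4 D
  ... | true = cong₂ _,_ (identity n a b) refl
    where
    identity : ∀ n a b → + 2 * (n * a) + n * b ≡ n * (+ 2 * a + b)
    identity = solve-∀
  ... | false = cong₂ _,_ (identity n a) (identity n b)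
    where
    identity : ∀ n a → + 2 * (n * a) ≡ n * (+ 2 * a)
    identity = solve-∀

  emb-ok : ∀ a → emb D (ok a) ≡ (+ 2 * a , + 0)
  emb-ok a with one-mod4 D
  ... | true = cong₂ _,_ (+-identityʳ (+ 2 * a)) refl
  ... | false = refl

  -- emb is twice the real embedding, hence the factor 2.
  emb-mul : ∀ x y → + 2 · emb D (mul D x y) ≡ emb D x ⊗ emb D y
  emb-mul (a , b) (c , e) with one-mod4 D in eq
  ... | true = cong₂ _,_
    (trans (identityˡ a b c e (+ (D / 4)))
      (cong (λ d → (+ 2 * a + b) * (+ 2 * c + e) + b * e * d) (sym (D≡1+4[D/4] eq))))
    (identityʳ a b c e)
    where
    identityˡ : ∀ a b c e q → + 2 * (+ 2 * (a * c + b * e * q) + (a * e + b * c + b * e))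
                             ≡ (+ 2 * a + b) * (+ 2 * c + e) + b * e * (+ 1 + + 4 * q)
    identityˡ = solve-∀
    identityʳ : ∀ a b c e → + 2 * (a * e + b * c + b * e) ≡ (+ 2 * a + b) * e + b * (+ 2 * c + e)
    identityʳ = solve-∀
  ... | false = cong₂ _,_ (identityˡ a b c e (+ D)) (identityʳ a b c e)
    where
    identityˡ : ∀ a b c e d → + 2 * (+ 2 * (a * c + b * e * d))
                             ≡ + 2 * a * (+ 2 * c) + + 2 * b * (+ 2 * e) * d
    identityˡ = solve-∀
    identityʳ : ∀ a b c e → + 2 * (+ 2 * (a * e + b * c)) ≡ + 2 * a * (+ 2 * e) + + 2 * b * (+ 2 * c)
    identityʳ = solve-∀

module OKArithmetic (D : ℕ) where

  open import Data.Nat using (_/_)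
  open import Data.Integer using (_+_; -_; _*_)
  open import Data.Integer.Properties using (+-comm; +-identityˡ)
  open import Data.Integer.Tactic.RingSolver using (solve-∀)
  open import Data.Bool using (true; false)
  open import Data.Product using (_,_)
  open import Relation.Binary.PropositionalEquality

  private
    distrib-first : ∀ a b c e c′ e′ q → a * (c′ + - c) + b * (e′ + - e) * q
                                      ≡ a * c′ + b * e′ * q + - (a * c + b * e * q)
    distrib-first = solve-∀

    identity-first : ∀ a b q → a * + 1 + b * + 0 * q ≡ a
    identity-first = solve-∀

    neg-difference : ∀ b e → - (b + - e) ≡ - b + - - e
    neg-difference = solve-∀

    neg-as-scalar : ∀ y → - y ≡ + 0 + - (y * + 1)
    neg-as-scalar = solve-∀

    double : ∀ y → y + - - y ≡ y * (+ 1 + + 1)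
    double = solve-∀

  mul-distribˡ-⊖ : ∀ x y z → mul D x (z ⊕ ⊖ y) ≡ mul D x z ⊕ ⊖ mul D x y
  mul-distribˡ-⊖ (a , b) (c , e) (c′ , e′) with one-mod4 D
  ... | true = cong₂ _,_ (distrib-first a b c e c′ e′ (+ (D / 4))) (distrib-second a b c e c′ e′)
    where
    distrib-second : ∀ a b c e c′ e′ → a * (e′ + - e) + b * (c′ + - c) + b * (e′ + - e)
                                     ≡ a * e′ + b * c′ + b * e′ + - (a * e + b * c + b * e)
    distrib-second = solve-∀
  ... | false = cong₂ _,_ (distrib-first a b c e c′ e′ (+ D)) (distrib-second a b c e c′ e′)
    where
    distrib-second : ∀ a b c e c′ e′ → a * (e′ + - e) + b * (c′ + - c) ≡ a * e′ + b * c′ + - (a * e + b * c)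
    distrib-second = solve-∀

  mul-identityʳ : ∀ x → mul D x (ok (+ 1)) ≡ x
  mul-identityʳ (a , b) with one-mod4 D
  ... | true = cong₂ _,_ (identity-first a b (+ (D / 4))) (identity-second a b)
    where
    identity-second : ∀ a b → a * + 0 + b * + 1 + b * + 0 ≡ b
    identity-second = solve-∀
  ... | false = cong₂ _,_ (identity-first a b (+ D)) (identity-second a b)
    where
    identity-second : ∀ a b → a * + 0 + b * + 1 ≡ b
    identity-second = solve-∀

  conj-⊖ : ∀ x y → conj D (x ⊕ ⊖ y) ≡ conj D x ⊕ ⊖ conj D y
  conj-⊖ (a , b) (c , e) with one-mod4 D
  ... | true = cong₂ _,_ (first a b c e) (neg-difference b e)
    where
    first : ∀ a b c e → a + - c + (b + - e) ≡ a + b + - (c + e)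
    first = solve-∀
  ... | false = cong₂ _,_ refl (neg-difference b e)

  conj-shift : ∀ a k b → conj D (a + k , b) ≡ ok k ⊕ conj D (a , b)
  conj-shift a k b with one-mod4 D
  ... | true = cong₂ _,_ (first a k b) (sym (+-identityˡ (- b)))
    where
    first : ∀ a k b → a + k + b ≡ k + (a + b)
    first = solve-∀
  ... | false = cong₂ _,_ (+-comm a k) (sym (+-identityˡ (- b)))

  -- ξ_D = −ω_D′, so c + yω_D′ = c − yξ_D.
  conj-ξ : ∀ c y → conj D (c , y) ≡ ok c ⊕ ⊖ (y · ξD D)
  conj-ξ c y with one-mod4 D
  ... | true = cong₂ _,_ (first c y) (neg-as-scalar y)
    where
    first : ∀ c y → c + y ≡ c + - (y * - + 1)
    first = solve-∀
  ... | false = cong₂ _,_ (first c y) (neg-as-scalar y)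
    where
    first : ∀ c y → c ≡ c + - (y * + 0)
    first = solve-∀

  ⊖-conj : ∀ a y → (a , y) ⊕ ⊖ conj D (a , y) ≡ y · (ξD D ⊕ ωD D)
  ⊖-conj a y with one-mod4 D
  ... | true = cong₂ _,_ (first a y) (double y)
    where
    first : ∀ a y → a + - (a + y) ≡ y * (- + 1 + + 0)
    first = solve-∀
  ... | false = cong₂ _,_ (first a y) (double y)
    where
    first : ∀ a y → a + - a ≡ y * (+ 0 + + 0)
    first = solve-∀

-- Le D x y and Lt D x y unfold to NonNeg (y ⊕ ⊖ x) and Pos D (y ⊕ ⊖ x). Since these predicates do not
-- determine their arguments, the elements are passed explicitly below.
module QuadraticOrder (D : ℕ) (0<D : + 0 ℤ.< + D) where

  open import Data.Nat using (z≤n; s≤s)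
  open import Data.Integer using (_-_; _≤_; _<_; +<+)
  import Data.Integer.Properties as ℤP
  open import Data.Product using (_×_; _,_; proj₁; proj₂)
  open import Data.Sum using (_⊎_; inj₁; inj₂)
  open import Function.Base using (_∘_)
  open import Relation.Binary.PropositionalEquality
  open import Relation.Binary.Structures using (IsPreorder)
  import Relation.Binary.Reasoning.Base.Triple as Triple
  open import Relation.Nullary using (¬_; yes; no)
  open IntegerInequalities using (i<j⇒0<j-i)
  open OKGroup
  open Embedding D
  open OKArithmetic D
  module R = RealQuadraticSigns D 0<D

  NonNegᵖ : ℤ × ℤ → Set
  NonNegᵖ (A , B) = NonNegR D A B

  Posᵖ : ℤ × ℤ → Set
  Posᵖ (A , B) = PosR D A B

  NonNeg : OK → Set
  NonNeg x = NonNegᵖ (emb D x)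

  nonneg-⊕ : ∀ {x y} → NonNeg x → NonNeg y → NonNeg (x ⊕ y)
  nonneg-⊕ {x} {y} x≥0 y≥0 = subst NonNegᵖ (sym (emb-⊕ x y)) (R.nonneg-+ x≥0 y≥0)

  pos-⊕ : ∀ {x y} → Pos D x → NonNeg y → Pos D (x ⊕ y)
  pos-⊕ {x} {y} x>0 y≥0 = subst Posᵖ (sym (emb-⊕ x y)) (R.pos-+-nonneg x>0 y≥0)

  pos⇒nonneg : ∀ {x} → Pos D x → NonNeg x
  pos⇒nonneg = R.pos⇒nonneg

  ¬nonneg⇒nonneg-⊖ : ∀ {x} → ¬ NonNeg x → NonNeg (⊖ x)
  ¬nonneg⇒nonneg-⊖ {x} ¬x≥0 = subst NonNegᵖ (sym (emb-⊖ x)) (R.¬nonneg⇒nonneg-neg ¬x≥0)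

  nonneg-· : ∀ {n x} → + 0 ≤ n → NonNeg x → NonNeg (n · x)
  nonneg-· {n} {x} 0≤n x≥0 = subst NonNegᵖ (sym (emb-· n x)) (R.nonneg-scale 0≤n x≥0)

  nonneg-mul : ∀ {x y} → NonNeg x → NonNeg y → NonNeg (mul D x y)
  nonneg-mul {x} {y} x≥0 y≥0 =
    R.nonneg-cancel {k = + 2} (+<+ (s≤s z≤n)) (subst NonNegᵖ (sym (emb-mul x y)) (R.nonneg-* x≥0 y≥0))

  nonneg-ok : ∀ {a} → + 0 ≤ a → NonNeg (ok a)
  nonneg-ok {a} 0≤a = subst NonNegᵖ (sym (emb-ok a)) (R.signs≥0 (ℤP.*-monoˡ-≤-nonNeg (+ 2) 0≤a) ℤP.≤-refl)

  pos-ok : ∀ {a} → + 0 < a → Pos D (ok a)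
  pos-ok {a} 0<a = subst Posᵖ (sym (emb-ok a)) (R.pos-rational (ℤP.*-monoˡ-<-pos (+ 2) 0<a) ℤP.≤-refl)

  ¬pos-0 : ¬ Pos D (ok (+ 0))
  ¬pos-0 0>0 = R.¬pos-0 (subst Posᵖ (emb-ok (+ 0)) 0>0)

  ≤-reflexive : ∀ {x y} → x ≡ y → Le D x y
  ≤-reflexive {x} refl = subst NonNeg (sym (⊖-self x)) (nonneg-ok ℤP.≤-refl)

  ≤-trans : ∀ {x y z} → Le D x y → Le D y z → Le D x z
  ≤-trans {x} {y} {z} x≤y y≤z = subst NonNeg (⊖-telescope x y z) (nonneg-⊕ {z ⊕ ⊖ y} {y ⊕ ⊖ x} y≤z x≤y)

  <-≤-trans : ∀ {x y z} → Lt D x y → Le D y z → Lt D x z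
  <-≤-trans {x} {y} {z} x<y y≤z =
    subst (Pos D) (trans (⊕-comm (y ⊕ ⊖ x) (z ⊕ ⊖ y)) (⊖-telescope x y z)) (pos-⊕ {y ⊕ ⊖ x} {z ⊕ ⊖ y} x<y y≤z)

  ≤-<-trans : ∀ {x y z} → Le D x y → Lt D y z → Lt D x z
  ≤-<-trans {x} {y} {z} x≤y y<z = subst (Pos D) (⊖-telescope x y z) (pos-⊕ {z ⊕ ⊖ y} {y ⊕ ⊖ x} y<z x≤y)

  <⇒≤ : ∀ {x y} → Lt D x y → Le D x y
  <⇒≤ {x} {y} = pos⇒nonneg {y ⊕ ⊖ x}

  <-trans : ∀ {x y z} → Lt D x y → Lt D y z → Lt D x z
  <-trans {x} {y} {z} x<y y<z = <-≤-trans {x} {y} {z} x<y (<⇒≤ {y} {z} y<z)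

  <-irrefl : ∀ {x} → ¬ Lt D x x
  <-irrefl {x} = ¬pos-0 ∘ subst (Pos D) (⊖-self x)

  <-asym : ∀ {x y} → Lt D x y → ¬ Lt D y x
  <-asym {x} {y} x<y y<x = <-irrefl {x} (<-trans {x} {y} {x} x<y y<x)

  ≤-total : ∀ x y → Le D x y ⊎ Le D y x
  ≤-total x y with R.nonneg? (proj₁ (emb D (y ⊕ ⊖ x))) (proj₂ (emb D (y ⊕ ⊖ x)))
  ... | yes x≤y = inj₁ x≤y
  ... | no x≰y = inj₂ (subst NonNeg (⊖-flip x y) (¬nonneg⇒nonneg-⊖ {y ⊕ ⊖ x} x≰y))

  ≤-isPreorder : IsPreorder _≡_ (Le D)
  ≤-isPreorder = record
    { isEquivalence = isEquivalence
    ; reflexive = ≤-reflexive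
    ; trans = λ {x y z} → ≤-trans {x} {y} {z}
    }

  module ≤-Reasoning = Triple ≤-isPreorder
    (λ {x y} → <-asym {x} {y}) (λ {x y z} → <-trans {x} {y} {z}) (resp₂ (Lt D)) (λ {x y} → <⇒≤ {x} {y})
    (λ {x y z} → <-≤-trans {x} {y} {z}) (λ {x y z} → ≤-<-trans {x} {y} {z})

  ok-mono-< : ∀ {m n} → m < n → Lt D (ok m) (ok n)
  ok-mono-< m<n = pos-ok (i<j⇒0<j-i m<n)

  ·-monoʳ-≤ : ∀ {m n w} → NonNeg w → m ≤ n → Le D (m · w) (n · w)
  ·-monoʳ-≤ {m} {n} {w} w≥0 m≤n =
    subst NonNeg (·-distribʳ-⊖ m n w) (nonneg-· {n - m} {w} (ℤP.i≤j⇒0≤j-i m≤n) w≥0)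

  mul-monoˡ-≤ : ∀ {x y z} → NonNeg x → Le D y z → Le D (mul D x y) (mul D x z)
  mul-monoˡ-≤ {x} {y} {z} x≥0 y≤z = subst NonNeg (mul-distribˡ-⊖ x y z) (nonneg-mul {x} {z ⊕ ⊖ y} x≥0 y≤z)

  x⊖z≤x : ∀ {x z} → NonNeg z → Le D (x ⊕ ⊖ z) x
  x⊖z≤x {x} {z} z≥0 = subst NonNeg (sym (⊖-⊖-cancel x z)) z≥0

module PartitionCounting where

  open import Data.Nat using (suc; _<_)
  open import Data.Nat.Properties using (<-irrefl; <-≤-trans; ≤-trans)
  open import Data.Fin using (Fin; zero; suc)
  open import Data.Fin.Properties using (injective⇒≤)
  open import Data.List using (List; []; _∷_)
  open import Data.List.Relation.Unary.All using ([]; _∷_)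
  open import Data.List.Relation.Binary.Permutation.Propositional using (_↭_; ↭-sym; ↭-trans)
  open import Data.List.Relation.Binary.Permutation.Propositional.Properties using (↭-length; drop-∷)
  open import Data.Product using (_,_; proj₁; proj₂)
  open import Data.Empty using (⊥-elim)
  open import Relation.Binary.PropositionalEquality
  open import Relation.Nullary using (¬_)
  open OKGroup using (⊕-identityʳ)

  private
    singleton-↭ : ∀ {x y : OK} {ys} → x ∷ [] ↭ y ∷ ys → ys ≡ []
    singleton-↭ {ys = []} _ = refl
    singleton-↭ {ys = _ ∷ _} p with ↭-length p
    ... | ()

  -- The one-part partition of α and δ prepended to each partition of β are p_K(β) + 1 pairwise
  -- inequivalent partitions of α.
  PK≡-<-⊕ : ∀ {D α β δ n₁ n₂} → TotPos D δ → TotPos D α → δ ⊕ β ≡ α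
    → PK≡ D β n₁ → PK≡ D α n₂ → n₁ < n₂
  PK≡-<-⊕ {D} {α} {β} {δ} {n₁} {n₂} δ≫0 α≫0 δ⊕β≡α
    (P , P-partitions , P-distinct , _) (Q , _ , _ , Q-complete) =
    injective⇒≤ {f = index} index-injective
    where
    extended : Fin (suc n₁) → List OK
    extended zero = α ∷ []
    extended (suc i) = δ ∷ P i

    extended-partitions : ∀ i → IsPartition D α (extended i)
    extended-partitions zero = (λ ()) , α≫0 ∷ [] , ⊕-identityʳ α
    extended-partitions (suc i) with P-partitions i
    ... | _ , parts≫0 , sum≡β = (λ ()) , δ≫0 ∷ parts≫0 , trans (cong (δ ⊕_) sum≡β) δ⊕β≡α

    index : Fin (suc n₁) → Fin n₂
    index i = proj₁ (Q-complete (extended i) (extended-partitions i))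

    ↭-of-index : ∀ i j → index i ≡ index j → extended i ↭ extended j
    ↭-of-index i j eq = ↭-trans (proj₂ (Q-complete _ (extended-partitions i)))
      (subst (λ k → Q k ↭ extended j) (sym eq) (↭-sym (proj₂ (Q-complete _ (extended-partitions j)))))

    nonempty : ∀ j → ¬ P j ≡ []
    nonempty j = proj₁ (P-partitions j)

    index-injective : ∀ {i j} → index i ≡ index j → i ≡ j
    index-injective {zero} {zero} _ = refl
    index-injective {zero} {suc j} eq = ⊥-elim (nonempty j (singleton-↭ (↭-of-index zero (suc j) eq)))
    index-injective {suc i} {zero} eq = ⊥-elim (nonempty i (singleton-↭ (↭-sym (↭-of-index (suc i) zero eq))))
    index-injective {suc i} {suc j} eq = cong suc (P-distinct i j (drop-∷ (↭-of-index (suc i) (suc j) eq)))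

  PK≥-⊕-¬PK≤ : ∀ {D α β δ m} → TotPos D δ → TotPos D α → δ ⊕ β ≡ α → PK≥ D β m → ¬ PK≤ D α m
  PK≥-⊕-¬PK≤ {D} {α} {β} {δ} δ≫0 α≫0 δ⊕β≡α (n₁ , p[β]≡n₁ , m≤n₁) (n₂ , p[α]≡n₂ , n₂≤m) =
    <-irrefl refl (<-≤-trans (PK≡-<-⊕ {D} {α} {β} {δ} δ≫0 α≫0 δ⊕β≡α p[β]≡n₁ p[α]≡n₂) (≤-trans n₂≤m m≤n₁))

module Bounds (D : ℕ) (0<D : + 0 ℤ.< + D) where

  open import Data.Nat as ℕ using (z≤n; s≤s)
  import Data.Nat.Properties as ℕP
  open import Data.Integer using (_+_; _-_; -_; _*_; _≤_; _<_; +≤+; +<+)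
  import Data.Integer.Properties as ℤP
  open import Data.Integer.Tactic.RingSolver using (solve-∀)
  open import Data.Bool using (true; false)
  open import Data.Product using (_,_; proj₂)
  open import Data.Sum using ([_,_]′)
  open import Data.Empty using (⊥)
  open import Relation.Binary.PropositionalEquality
  open import Relation.Nullary using (¬_)
  open IntegerInequalities using (i<j⇒0<j-i)
  open OKGroup
  open OKArithmetic D
  open QuadraticOrder D 0<D
  open RealQuadraticSigns D 0<D using (pos-surd)
  open PartitionCounting

  ξ+ω>0 : Pos D (ξD D ⊕ ωD D)
  ξ+ω>0 with one-mod4 D
  ... | true = pos-surd (+≤+ z≤n) (+<+ (s≤s z≤n))
  ... | false = pos-surd (+≤+ z≤n) (+<+ (s≤s z≤n))

  conj-pos⇒totPos : ∀ {a b} → Pos D (conj D (a , b)) → + 0 ≤ b → TotPos D (a , b)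
  conj-pos⇒totPos {a} {b} x′>0 0≤b = subst (Pos D) (⊕-⊖-cancel x x′) x>0 , x′>0
    where
    x x′ : OK
    x = (a , b)
    x′ = conj D x
    x-x′≥0 : NonNeg (x ⊕ ⊖ x′)
    x-x′≥0 = subst NonNeg (sym (⊖-conj a b)) (nonneg-· {b} {ξD D ⊕ ωD D} 0≤b (pos⇒nonneg {ξD D ⊕ ωD D} ξ+ω>0))
    x>0 : Pos D (x′ ⊕ (x ⊕ ⊖ x′))
    x>0 = pos-⊕ {x′} {x ⊕ ⊖ x′} x′>0 x-x′≥0

  ceil-conj-nonneg : ∀ {y c} → IsCeil D (y · ξD D) c → NonNeg (conj D (c , y))
  ceil-conj-nonneg {y} {c} (yξ≤c , _) = subst NonNeg (sym (conj-ξ c y)) yξ≤c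

  ceil-conj<1 : ∀ {y c} → IsCeil D (y · ξD D) c → Lt D (conj D (c , y)) (ok (+ 1))
  ceil-conj<1 {y} {c} (_ , c-1<yξ) =
    subst (Pos D) (trans (shift c (y · ξD D)) (cong (λ w → ok (+ 1) ⊕ ⊖ w) (sym (conj-ξ c y)))) c-1<yξ
    where
    shift : ∀ c z → z ⊕ ⊖ ok (c - + 1) ≡ ok (+ 1) ⊕ ⊖ (ok c ⊕ ⊖ z)
    shift c (z₁ , z₂) = cong₂ _,_ (first c z₁) (second z₂)
      where
      first : ∀ c z → z + - (c - + 1) ≡ + 1 + - (c + - z)
      first = solve-∀
      second : ∀ z → z + - + 0 ≡ + 0 + - (+ 0 + - z)
      second = solve-∀

  ceil-shift-conj-nonneg : ∀ {y c t} → IsCeil D (y · ξD D) c → + 0 ≤ t → NonNeg (conj D (c + t , y))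
  ceil-shift-conj-nonneg {y} {c} {t} ceil 0≤t = subst NonNeg (sym (conj-shift c t y))
    (nonneg-⊕ {ok t} {conj D (c , y)} (nonneg-ok 0≤t) (ceil-conj-nonneg {y} {c} ceil))

  ceil-shift-totPos : ∀ {y c t} → IsCeil D (+ y · ξD D) c → + 0 < t → TotPos D (c + t , + y)
  ceil-shift-totPos {y} {c} {t} ceil 0<t = conj-pos⇒totPos {c + t} {+ y}
    (subst (Pos D) (sym (conj-shift c t (+ y)))
      (pos-⊕ {ok t} {conj D (c , + y)} (pos-ok 0<t) (ceil-conj-nonneg {+ y} {c} ceil)))
    (+≤+ z≤n)

  k-bound : ∀ {m kmax y k c} → IsCeil D (+ y · ξD D) c
    → PK≥ D (ok (+ kmax)) m → PK≤ D (c + + k , + y) m → k ℕ.≤ kmax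
  k-bound {m} {kmax} {y} {k} {c} ceil p[kmax]≥m p[α]≤m = ℕP.≮⇒≥ λ kmax<k →
    PK≥-⊕-¬PK≤ {D} {α} {ok (+ kmax)} {δ} (δ≫0 kmax<k) (α≫0 kmax<k) δ⊕kmax≡α p[kmax]≥m p[α]≤m
    where
    α δ : OK
    α = (c + + k , + y)
    δ = (c + (+ k - + kmax) , + y)
    δ≫0 : kmax ℕ.< k → TotPos D δ
    δ≫0 kmax<k = ceil-shift-totPos {y} {c} ceil (i<j⇒0<j-i (+<+ kmax<k))
    α≫0 : kmax ℕ.< k → TotPos D α
    α≫0 kmax<k = ceil-shift-totPos {y} {c} ceil (+<+ (ℕP.≤-<-trans z≤n kmax<k))
    δ⊕kmax≡α : δ ⊕ ok (+ kmax) ≡ α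
    δ⊕kmax≡α = cong₂ _,_ (cancel c (+ k) (+ kmax)) (ℤP.+-identityʳ (+ y))
      where
      cancel : ∀ c k l → c + (k - l) + l ≡ c + k
      cancel = solve-∀

  y-bound-small-conjugate : ∀ {ε n a y} → NonNeg ε → Lt D ε (n · (ξD D ⊕ ωD D)) → n ≤ y
    → NonNeg (conj D (a , y)) → Le D (conj D (a , y)) (ok (+ 1))
    → Le D (a , y) (mul D ε (conj D (a , y))) → ⊥
  y-bound-small-conjugate {ε} {n} {a} {y} ε≥0 ε<n[ξ+ω] n≤y α′≥0 α′≤1 α≤εα′ = <-irrefl {α} (begin-strict
    α                      ≤⟨ α≤εα′ ⟩
    mul D ε α′             ≤⟨ mul-monoˡ-≤ {ε} {α′} {ok (+ 1)} ε≥0 α′≤1 ⟩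
    mul D ε (ok (+ 1))     ≡⟨ mul-identityʳ ε ⟩
    ε                      <⟨ ε<n[ξ+ω] ⟩
    n · (ξD D ⊕ ωD D)      ≤⟨ ·-monoʳ-≤ {n} {y} {ξD D ⊕ ωD D} (pos⇒nonneg {ξD D ⊕ ωD D} ξ+ω>0) n≤y ⟩
    y · (ξD D ⊕ ωD D)      ≡⟨ sym (⊖-conj a y) ⟩
    α ⊕ ⊖ α′               ≤⟨ x⊖z≤x {α} {α′} α′≥0 ⟩
    α                      ∎)
    where
    open ≤-Reasoning
    α = (a , y)
    α′ = conj D α

  -- δ = α − β has δ′ = α′ − β′ > 1 − 1 = 0.
  y-bound-large-conjugate : ∀ {m ymax cmax y a} → ymax ℕ.< y → IsCeil D (+ ymax · ξD D) cmax
    → Le D (ok (+ 1)) (conj D (a , + y))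
    → PK≥ D ((cmax , + 0) ⊕ (+ ymax · ωD D)) m → ¬ PK≤ D (a , + y) m
  y-bound-large-conjugate {m} {ymax} {cmax} {y} {a} ymax<y ceil 1≤α′ =
    PK≥-⊕-¬PK≤ {D} {α} {β} {δ} δ≫0 α≫0 δ⊕β≡α
    where
    α β′ β δ : OK
    α = (a , + y)
    β′ = (cmax , + ymax)
    β = (cmax , + 0) ⊕ (+ ymax · ωD D)
    δ = α ⊕ ⊖ β′
    δ≫0 : TotPos D δ
    δ≫0 = conj-pos⇒totPos {a - cmax} {+ y - + ymax}
      (subst (Pos D) (sym (conj-⊖ α β′))
        (<-≤-trans {conj D β′} {ok (+ 1)} {conj D α} (ceil-conj<1 {+ ymax} {cmax} ceil) 1≤α′))
      (ℤP.i≤j⇒0≤j-i (+≤+ (ℕP.<⇒≤ ymax<y)))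
    α≫0 : TotPos D α
    α≫0 = conj-pos⇒totPos {a} {+ y}
      (subst (Pos D) (⊕-identityʳ (conj D α))
        (<-≤-trans {ok (+ 0)} {ok (+ 1)} {conj D α} (ok-mono-< {+ 0} {+ 1} (+<+ (s≤s z≤n))) 1≤α′))
      (+≤+ z≤n)
    δ⊕β≡α : δ ⊕ β ≡ α
    δ⊕β≡α = cong₂ _,_ (first a cmax (+ ymax)) (second (+ y) (+ ymax))
      where
      first : ∀ a c n → a + - c + (c + n * + 0) ≡ a
      first = solve-∀
      second : ∀ y n → y + - n + (+ 0 + n * + 1) ≡ y
      second = solve-∀

  y-bound : ∀ {m ε ymax f cmax y k c} → Pos D ε → IsFloorDiv D ε (ξD D ⊕ ωD D) f → f ≤ + ymax
    → IsCeil D (+ ymax · ξD D) cmax → PK≥ D ((cmax , + 0) ⊕ (+ ymax · ωD D)) m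
    → IsCeil D (+ y · ξD D) c → Le D (c + + k , + y) (mul D ε (conj D (c + + k , + y)))
    → PK≤ D (c + + k , + y) m → y ℕ.≤ ymax
  y-bound {m} {ε} {ymax} {f} {cmax} {y} {k} {c} ε>0 floor f≤ymax ceil-max p[β]≥m ceil α≤εα′ p[α]≤m =
    ℕP.≮⇒≥ λ ymax<y → [ large ymax<y , small ymax<y ]′ (≤-total (ok (+ 1)) α′)
    where
    α′ : OK
    α′ = conj D (c + + k , + y)
    large : ymax ℕ.< y → Le D (ok (+ 1)) α′ → ⊥
    large ymax<y 1≤α′ =
      y-bound-large-conjugate {m} {ymax} {cmax} {y} {c + + k} ymax<y ceil-max 1≤α′ p[β]≥m p[α]≤m
    small : ymax ℕ.< y → Le D α′ (ok (+ 1)) → ⊥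
    small ymax<y α′≤1 = y-bound-small-conjugate {ε} {f + + 1} {c + + k} {+ y}
      (pos⇒nonneg {ε} ε>0) (proj₂ floor) f+1≤y
      (ceil-shift-conj-nonneg {+ y} {c} {+ k} ceil (+≤+ z≤n)) α′≤1 α≤εα′
      where
      f+1≤y : f + + 1 ≤ + y
      f+1≤y = subst (_≤ + y) (ℤP.+-comm (+ 1) f) (ℤP.i<j⇒suc[i]≤j (ℤP.≤-<-trans f≤ymax (+<+ ymax<y)))

open import Data.Nat using (_≤_; z≤n; s≤s)
open import Data.Nat.Properties using (<-≤-trans)
open import Data.Integer using (_+_)
open import Data.Product using (_×_; _,_; proj₁)
open import Relation.Binary.PropositionalEquality using (_≡_)
open import Relation.Nullary using (¬_)

lemma5p4 : (D : ℕ) → 2 ≤ D → SquareFree D → (m : ℕ) → 1 ≤ m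
    → (ε : OK) → IsEpsPlus D ε
    → (kmax : ℕ) → 1 ≤ kmax → PK≥ D (ok (+ kmax)) m
    → (ymax : ℕ) → (f : ℤ) → IsFloorDiv D ε (ξD D ⊕ ωD D) f → f ℤ.≤ + ymax
    → (cmax : ℤ) → IsCeil D (+ ymax · ξD D) cmax
    → PK≥ D ((cmax , + 0) ⊕ (+ ymax · ωD D)) m
    → (y k : ℕ) → (c : ℤ) → IsCeil D (+ y · ξD D) c
    → ¬ (((c + + k) , + y) ≡ ok (+ 0))
    → Le D (c + + k , + y) (mul D ε (conj D (c + + k , + y)))
    → PK≤ D (c + + k , + y) m
    → k ≤ kmax × y ≤ ymax
lemma5p4 D 2≤D _ m _ ε ε₊ kmax _ p[kmax]≥m ymax f floor f≤ymax cmax ceil-max p[β]≥m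
         y k c ceil _ α≤εα′ p[α]≤m =
  k-bound {m} {kmax} {y} {k} {c} ceil p[kmax]≥m p[α]≤m ,
  y-bound {m} {ε} {ymax} {f} {cmax} {y} {k} {c} ε>0 floor f≤ymax ceil-max p[β]≥m ceil α≤εα′ p[α]≤m
  where
  open Bounds D (ℤ.+<+ (<-≤-trans (s≤s z≤n) 2≤D))
  ε>0 : Pos D ε
  ε>0 = proj₁ (proj₁ (proj₁ ε₊))
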